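{- For all positive integers $t,k$, $\alpha(2^t\cdot k) \leq \alpha(k)$.
   Context: For a finite family $\mathcal{S}=\{S_1,\dots,S_r\}$ of finite sets, $\mathbf{ID}(\mathcal{S})=2^{S_1}\cup\cdots\cup 2^{S_r}$ (all sets contained in some member of $\mathcal{S}$). For a positive integer $k$, $\alpha(k)$ is the minimum of $|\mathcal{S}|$ over all finite families $\mathcal{S}$ of finite sets with $|\mathbf{ID}(\mathcal{S})|=k$. -}

module Defs where

open import Data.Nat using (ℕ; zero; suc)
open import Data.Bool using (true; false)
open import Data.List using (List; []; _∷_; map; _++_; filter; length)
open import Data.List.Relation.Unary.Any using (Any; any?)
open import Data.Vec using (_∷_; [])
open import Data.Fin.Subset using (Subset; _⊆_)
open import Data.Fin.Subset.Properties using (_⊆?_)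

-- A finite family of finite sets, realised over a ground set Fin n
-- (every finite family of finite sets is isomorphic to one of these).
Family : ℕ → Set
Family n = List (Subset n)

allSubsets : (n : ℕ) → List (Subset n)
allSubsets zero    = [] ∷ []
allSubsets (suc n) = map (false ∷_) (allSubsets n) ++ map (true ∷_) (allSubsets n)

-- ID(S) = union of the power sets of the members of S, as a list of
-- subsets of Fin n (without repetition).
ID : {n : ℕ} → Family n → List (Subset n)
ID {n} S = filter (λ X → any? (λ Si → X ⊆? Si) S) (allSubsets n)

∣ID∣ : {n : ℕ} → Family n → ℕ
∣ID∣ S = length (ID S)

-- Adjoining one new point to every member of S doubles |ID(S)|: a set lies below some
-- member of the new family iff its trace on the old ground set lies below the
-- corresponding old member, whether or not it contains the new point. The family keeps
-- its size and stays repetition-free, so t new points multiply |ID(S)| by 2^t.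
module Submission where

open import Defs
open import Data.Nat using (ℕ; suc; _+_; _*_; _^_; _≤_)
open import Data.Nat.Properties using (≤-reflexive; +-identityʳ; *-assoc)
open import Data.Product using (Σ; _×_; _,_)
open import Data.List using (List; []; _∷_; _++_; length; map; filter)
open import Data.List.Properties using (filter-++; length-++; length-map)
open import Data.List.Relation.Unary.Any as Any using (Any)
import Data.List.Relation.Unary.Any.Properties as Anyₚ
open import Data.List.Relation.Unary.Unique.Propositional using (Unique)
import Data.List.Relation.Unary.Unique.Propositional.Properties as Uniqueₚ
open import Data.Vec using (_∷_)
open import Data.Vec.Properties using (∷-injectiveʳ)
open import Data.Fin.Subset using (Subset; Side; inside; outside; _⊆_)
open import Data.Fin.Subset.Properties using (_⊆?_; drop-∷-⊆; out⊆; in⊆in)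
open import Function.Bundles using (_⇔_; mk⇔; Equivalence)
open import Relation.Nullary using (yes; no; contradiction)
open import Relation.Unary using (Pred; Decidable)
open import Relation.Binary.PropositionalEquality using (_≡_; refl; cong; cong₂; sym; module ≡-Reasoning)

length-filter-map : ∀ {a b p q} {A : Set a} {B : Set b} {P : Pred A p} {Q : Pred B q}
  (P? : Decidable P) (Q? : Decidable Q) (f : A → B) → (∀ x → Q (f x) ⇔ P x) →
  ∀ xs → length (filter Q? (map f xs)) ≡ length (filter P? xs)
length-filter-map P? Q? f Qf⇔P [] = refl
length-filter-map P? Q? f Qf⇔P (x ∷ xs) with Q? (f x) | P? x
... | yes _   | yes _  = cong suc (length-filter-map P? Q? f Qf⇔P xs)
... | no _    | no _   = length-filter-map P? Q? f Qf⇔P xs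
... | yes Qfx | no ¬Px = contradiction (Equivalence.to (Qf⇔P x) Qfx) ¬Px
... | no ¬Qfx | yes Px = contradiction (Equivalence.from (Qf⇔P x) Px) ¬Qfx

∷⊆inside∷-⇔ : ∀ {n} (s : Side) {p q : Subset n} → s ∷ p ⊆ inside ∷ q ⇔ p ⊆ q
∷⊆inside∷-⇔ inside  = mk⇔ drop-∷-⊆ in⊆in
∷⊆inside∷-⇔ outside = mk⇔ drop-∷-⊆ out⊆

addPoint : ∀ {n} → Family n → Family (suc n)
addPoint = map (inside ∷_)

addPoints : ∀ t {n} → Family n → Family (t + n)
addPoints 0       S = S
addPoints (suc t) S = addPoint (addPoints t S)

Any⊆-addPoint-⇔ : ∀ {n} (s : Side) (p : Subset n) (S : Family n) →
  Any (s ∷ p ⊆_) (addPoint S) ⇔ Any (p ⊆_) S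
Any⊆-addPoint-⇔ s p S = mk⇔
  (λ h → Any.map (Equivalence.to (∷⊆inside∷-⇔ s)) (Anyₚ.map⁻ h))
  (λ h → Anyₚ.map⁺ (Any.map (Equivalence.from (∷⊆inside∷-⇔ s)) h))

∣ID∣-addPoint : ∀ {n} (S : Family n) → ∣ID∣ (addPoint S) ≡ 2 * ∣ID∣ S
∣ID∣-addPoint {n} S = begin
  length (filter covered′? (map (outside ∷_) all ++ map (inside ∷_) all))
    ≡⟨ cong length (filter-++ covered′? (map (outside ∷_) all) _) ⟩
  length (filter covered′? (map (outside ∷_) all) ++ filter covered′? (map (inside ∷_) all))
    ≡⟨ length-++ (filter covered′? (map (outside ∷_) all)) ⟩
  length (filter covered′? (map (outside ∷_) all)) + length (filter covered′? (map (inside ∷_) all))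
    ≡⟨ cong₂ _+_ (halfCount outside) (halfCount inside) ⟩
  ∣ID∣ S + ∣ID∣ S
    ≡⟨ cong (∣ID∣ S +_) (sym (+-identityʳ (∣ID∣ S))) ⟩
  2 * ∣ID∣ S ∎
  where
  open ≡-Reasoning
  all : List (Subset n)
  all = allSubsets n
  covered? : Decidable (λ X → Any (X ⊆_) S)
  covered? X = Any.any? (X ⊆?_) S
  covered′? : Decidable (λ X → Any (X ⊆_) (addPoint S))
  covered′? X = Any.any? (X ⊆?_) (addPoint S)
  halfCount : ∀ s → length (filter covered′? (map (s ∷_) all)) ≡ ∣ID∣ S
  halfCount s = length-filter-map covered? covered′? (s ∷_) (λ p → Any⊆-addPoint-⇔ s p S) all

∣ID∣-addPoints : ∀ t {n} (S : Family n) → ∣ID∣ (addPoints t S) ≡ 2 ^ t * ∣ID∣ S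
∣ID∣-addPoints 0       S = sym (+-identityʳ (∣ID∣ S))
∣ID∣-addPoints (suc t) S = begin
  ∣ID∣ (addPoint (addPoints t S)) ≡⟨ ∣ID∣-addPoint (addPoints t S) ⟩
  2 * ∣ID∣ (addPoints t S)        ≡⟨ cong (2 *_) (∣ID∣-addPoints t S) ⟩
  2 * (2 ^ t * ∣ID∣ S)            ≡⟨ sym (*-assoc 2 (2 ^ t) (∣ID∣ S)) ⟩
  2 ^ suc t * ∣ID∣ S              ∎
  where open ≡-Reasoning

addPoints-unique : ∀ t {n} {S : Family n} → Unique S → Unique (addPoints t S)
addPoints-unique 0       u = u
addPoints-unique (suc t) u = Uniqueₚ.map⁺ ∷-injectiveʳ (addPoints-unique t u)

length-addPoints : ∀ t {n} (S : Family n) → length (addPoints t S) ≡ length S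
length-addPoints 0       S = refl
length-addPoints (suc t) S = begin
  length (addPoint (addPoints t S)) ≡⟨ length-map (inside ∷_) (addPoints t S) ⟩
  length (addPoints t S)            ≡⟨ length-addPoints t S ⟩
  length S                          ∎
  where open ≡-Reasoning

lemma19 : (t k : ℕ) → 1 ≤ t → 1 ≤ k →
    (n : ℕ) (S : Family n) → Unique S → ∣ID∣ S ≡ k →
    Σ ℕ (λ m → Σ (Family m) (λ S' → Unique S' × ∣ID∣ S' ≡ 2 ^ t * k × length S' ≤ length S))
lemma19 t k _ _ n S unique refl =
  t + n , addPoints t S , addPoints-unique t unique ,
  ∣ID∣-addPoints t S , ≤-reflexive (length-addPoints t S)
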